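{- If $G$ and $H$ are almost-3-symmetric graphs, then $\operatorname{inflate}(G,H)$ is also almost-3-symmetric.
   Context: All graphs are finite simple graphs. For a graph $S$ on $k$ vertices and a graph $G$ on $n$ vertices, $t(S,G)$ is the number of $k$-element vertex subsets of $G$ inducing a subgraph isomorphic to $S$, divided by $\binom{n}{k}$; if $n<k$, $t(S,G)=0$. A graph $G$ on $n$ vertices is 2-symmetric if $n<2$, or $n\ge 2$ and its edge density is exactly $1/2$. A graph $G$ is almost-3-symmetric if (i) $G$ is 2-symmetric, (ii) $t(K_3,G)=t(\overline{K_3},G)$, and (iii) $t(P_3,G)=t(\overline{P_3},G)$, where $K_3$ is the triangle, $\overline{K_3}$ the edgeless graph on 3 vertices, $P_3$ the path on 3 vertices, $\overline{P_3}$ the graph on 3 vertices with exactly one edge. The inflation $\operatorname{inflate}(G,H)$ is the graph with vertex set $V(G)\times V(H)$ in which $(u,a)$ and $(v,b)$ are adjacent iff either $u=v$ and $ab\in E(H)$, or $uv\in E(G)$. -}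

module Defs where

open import Data.Nat using (ℕ; zero; suc; _+_; _*_; _<_)
open import Data.Nat.Combinatorics using (_C_)
open import Data.Bool using (Bool; true; false; if_then_else_)
open import Data.Fin using (Fin; toℕ; remQuot)
open import Data.Fin.Properties using (_≟_)
open import Data.Product using (_×_; _,_; proj₁; proj₂)
open import Data.List using (List; []; _∷_; length; filter; allFin; concatMap)
open import Data.Sum using (_⊎_)
open import Relation.Nullary using (yes; no; ¬_)
open import Relation.Nullary.Decidable using (⌊_⌋)
open import Relation.Binary.PropositionalEquality using (_≡_; refl)
open import Data.Nat using (_<?_)

record Graph : Set where
  field
    n     : ℕ
    adj   : Fin n → Fin n → Bool
    adjSym : ∀ u v → adj u v ≡ adj v u
    irrefl : ∀ u → adj u u ≡ false

open Graph public

bcount : List Bool → ℕ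
bcount [] = 0
bcount (true ∷ bs) = suc (bcount bs)
bcount (false ∷ bs) = bcount bs

pairs : (n : ℕ) → List (Fin n × Fin n)
pairs n = concatMap (λ i → concatMap (λ j →
            if ⌊ toℕ i <? toℕ j ⌋ then (i , j) ∷ [] else []) (allFin n)) (allFin n)

triples : (n : ℕ) → List (Fin n × Fin n × Fin n)
triples n = concatMap (λ i → concatMap (λ j → concatMap (λ k →
              if ⌊ toℕ i <? toℕ j ⌋ then (if ⌊ toℕ j <? toℕ k ⌋ then (i , j , k) ∷ [] else [])
              else []) (allFin n)) (allFin n)) (allFin n)

edgeCount : Graph → ℕ
edgeCount G = bcount (Data.List.map (λ p → adj G (proj₁ p) (proj₂ p)) (pairs (n G)))

edgesOn : (G : Graph) → Fin (n G) × Fin (n G) × Fin (n G) → ℕ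
edgesOn G (i , j , k) = bcount (adj G i j ∷ adj G i k ∷ adj G j k ∷ [])

-- a 3-vertex graph is determined up to isomorphism by its number of edges:
-- 0 = complement of K3, 1 = complement of P3, 2 = P3, 3 = K3.
-- inducedCount3 G e = number of 3-subsets of V(G) inducing a graph with e edges
inducedCount3 : Graph → ℕ → ℕ
inducedCount3 G e = length (filter (λ t → edgesOn G t Data.Nat.≟ e) (triples (n G)))

-- t(S,G) for 3-vertex S, as numerator over the common denominator (n choose 3)
countK3 countK3bar countP3 countP3bar : Graph → ℕ
countK3    G = inducedCount3 G 3
countP3    G = inducedCount3 G 2
countP3bar G = inducedCount3 G 1
countK3bar G = inducedCount3 G 0

-- edge density exactly 1/2 : |E| / (n choose 2) = 1/2
TwoSymmetric : Graph → Set
TwoSymmetric G = (n G < 2) ⊎ (2 * edgeCount G ≡ n G C 2)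

-- t(K3,G) = t(K3bar,G) and t(P3,G) = t(P3bar,G); both t's share the
-- denominator (n choose 3) (or are both 0 when n < 3), so equality of t's
-- is equality of the induced-copy counts.
record Almost3Symmetric (G : Graph) : Set where
  field
    twoSym : TwoSymmetric G
    triEq  : countK3 G ≡ countK3bar G
    pathEq : countP3 G ≡ countP3bar G

-- inflation: vertex set V(G) × V(H) encoded as Fin (n G * n H) via remQuot
inflAdj : (G H : Graph) → Fin (n G) × Fin (n H) → Fin (n G) × Fin (n H) → Bool
inflAdj G H (u , a) (v , b) with u ≟ v
... | yes _ = adj H a b
... | no  _ = adj G u v

inflAdj-sym : (G H : Graph) → ∀ x y → inflAdj G H x y ≡ inflAdj G H y x
inflAdj-sym G H (u , a) (v , b) with u ≟ v | v ≟ u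
... | yes _ | yes _ = Graph.adjSym H a b
... | yes p | no ¬q = Data.Empty.⊥-elim (¬q (Relation.Binary.PropositionalEquality.sym p))
  where import Data.Empty
... | no ¬p | yes q = Data.Empty.⊥-elim (¬p (Relation.Binary.PropositionalEquality.sym q))
  where import Data.Empty
... | no _ | no _ = Graph.adjSym G u v

inflAdj-irrefl : (G H : Graph) → ∀ x → inflAdj G H x x ≡ false
inflAdj-irrefl G H (u , a) with u ≟ u
... | yes _ = irrefl H a
... | no ¬p = Data.Empty.⊥-elim (¬p refl)
  where import Data.Empty

inflate : Graph → Graph → Graph
inflate G H = record
  { n = n G * n H
  ; adj = λ x y → inflAdj G H (remQuot (n H) x) (remQuot (n H) y)
  ; adjSym = λ x y → inflAdj-sym G H (remQuot (n H) x) (remQuot (n H) y)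
  ; irrefl = λ x → inflAdj-irrefl G H (remQuot (n H) x)
  }

-- Order V(G) × V(H) lexicographically, as `combine` does.  A 3-subset of the inflation meets
-- three blocks, two blocks or one block.  Across three blocks it induces the graph induced by
-- its three G-coordinates, each G-triple arising |H|³ times; inside one block it induces an
-- H-triple.  A triple with two vertices a, b in block u and one in block v ≠ u sees the edge
-- uv twice and ab once; writing m_e for the number of pairs (u < v, a < b) for which this
-- gives e edges, and letting the lone vertex come before or after the pair,
--   c_e(inflate G H) = |H|³ c_e(G) + 2 |H| m_e + |G| c_e(H).
-- With E and Ē the numbers of edges and non-edges, m₃ = E(G) E(H), m₀ = Ē(G) Ē(H),
-- m₂ = E(G) Ē(H) and m₁ = Ē(G) E(H).  2-symmetry says E = Ē, so m₃ = m₀ and m₂ = m₁, and both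
-- balances pass to the inflation; E = Ē itself passes since E(inflate G H) = |H|² E(G) + |G| E(H),
-- and likewise for Ē.

module Submission where

open import Defs
open import Data.Bool using (Bool; true; false; not; if_then_else_)
open import Data.Empty using (⊥-elim)
open import Data.Fin using (Fin; toℕ; combine; _↑ˡ_; _↑ʳ_) renaming (zero to fzero; suc to fsuc)
open import Data.Fin.Properties using (_≟_; <⇒≢; <-cmp; toℕ-combine; remQuot-combine; combine-monoˡ-<)
open import Data.List using (List; []; _∷_; _++_; length; filter; map; concatMap; tabulate; allFin)
open import Data.List.Properties using (map-++; filter-++; length-++)
open import Data.Nat using (ℕ; zero; suc; _+_; _*_; _<_; _<?_; s<s; s<s⁻¹)
import Data.Nat as ℕ
open import Data.Nat.Combinatorics using (_C_; nC1≡n; nCk+nC[k+1]≡[n+1]C[k+1])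
open import Data.Nat.Combinatorics.Specification using (k>n⇒nCk≡0)
open import Data.Nat.Properties
  using (+-*-semiring; *-commutativeSemigroup; +-assoc; +-identityʳ; *-comm; *-assoc; *-zeroʳ
        ; *-identityˡ; *-identityʳ; *-distribˡ-+; *-distribʳ-+; +-cancelˡ-≡; m+n≡0⇒m≡0; m+n≡0⇒n≡0
        ; <-irrefl; <-asym; <-trans; +-monoʳ-<; +-cancelˡ-<)
open import Data.Product using (_×_; _,_)
open import Data.Sum using (inj₁; inj₂)
open import Function using (_∘_; id; mk⇔)
open import Relation.Binary using (tri<; tri≈; tri>)
open import Relation.Binary.PropositionalEquality
  using (_≡_; refl; sym; trans; cong; cong₂; module ≡-Reasoning)
open import Relation.Nullary using (¬_; Dec; does; yes; no)
open import Relation.Nullary.Decidable using (⌊_⌋; isYes≗does; dec-true; dec-false; does-⇔)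
open import Relation.Unary using (Decidable)
open import Algebra.Properties.CommutativeSemigroup *-commutativeSemigroup using (x∙yz≈y∙xz)
open import Algebra.Properties.Semiring.Sum +-*-semiring
  using (sum-syntax; sum-cong-≗; ∑-distrib-+; ∑-comm; *-distribˡ-sum)

⟦_⟧ : Bool → ℕ
⟦ true ⟧ = 1
⟦ false ⟧ = 0

[_<_] : ∀ {n} → Fin n → Fin n → ℕ
[ i < j ] = ⟦ does (toℕ i <? toℕ j) ⟧

δ : ∀ {n} → Fin n → Fin n → ℕ
δ i j = ⟦ does (i ≟ j) ⟧

[<]-yes : ∀ {n} {i j : Fin n} → toℕ i < toℕ j → [ i < j ] ≡ 1
[<]-yes {i = i} {j} i<j = cong ⟦_⟧ (dec-true (toℕ i <? toℕ j) i<j)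

[<]-no : ∀ {n} {i j : Fin n} → ¬ toℕ i < toℕ j → [ i < j ] ≡ 0
[<]-no {i = i} {j} i≮j = cong ⟦_⟧ (dec-false (toℕ i <? toℕ j) i≮j)

[<]-suc : ∀ {n} (i j : Fin n) → [ fsuc i < fsuc j ] ≡ [ i < j ]
[<]-suc i j = cong ⟦_⟧ (does-⇔ (mk⇔ s<s⁻¹ s<s) (suc (toℕ i) <? suc (toℕ j)) (toℕ i <? toℕ j))

δ-≢ : ∀ {n} {i j : Fin n} → ¬ i ≡ j → δ i j ≡ 0
δ-≢ {i = i} {j} i≢j = cong ⟦_⟧ (dec-false (i ≟ j) i≢j)

δ-refl : ∀ {n} (i : Fin n) → δ i i ≡ 1
δ-refl i = cong ⟦_⟧ (dec-true (i ≟ i) refl)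

sum-const : ∀ n c → ∑[ i < n ] c ≡ n * c
sum-const zero c = refl
sum-const (suc n) c = cong (c +_) (sum-const n c)

sum-const² : ∀ m c → ∑[ a < m ] ∑[ b < m ] c ≡ m * (m * c)
sum-const² m c = trans (sum-cong-≗ {m} λ _ → sum-const m c) (sum-const m (m * c))

sum-const³ : ∀ m c → ∑[ a < m ] ∑[ b < m ] ∑[ d < m ] c ≡ m * (m * (m * c))
sum-const³ m c = trans (sum-cong-≗ {m} λ _ → sum-const² m c) (sum-const m (m * (m * c)))

sum-*ˡ : ∀ {n} c (f : Fin n → ℕ) → ∑[ i < n ] (c * f i) ≡ c * ∑[ i < n ] f i
sum-*ˡ c f = sym (*-distribˡ-sum c f)

sum-δ : ∀ {n} (i : Fin n) (f : Fin n → ℕ) → ∑[ j < n ] (δ i j * f j) ≡ f i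
sum-δ {suc n} fzero    f =
  trans (cong₂ _+_ (*-identityˡ (f fzero)) (trans (sum-const n 0) (*-zeroʳ n))) (+-identityʳ (f fzero))
sum-δ {suc n} (fsuc i) f = sum-δ i (f ∘ fsuc)

sum-↑ : ∀ m {n} (f : Fin (m + n) → ℕ) → ∑[ x < m + n ] f x ≡ ∑[ i < m ] f (i ↑ˡ n) + ∑[ j < n ] f (m ↑ʳ j)
sum-↑ zero    f = refl
sum-↑ (suc m) f = trans (cong (f fzero +_) (sum-↑ m (f ∘ fsuc))) (sym (+-assoc (f fzero) _ _))

sum-combine : ∀ m {n} (f : Fin (m * n) → ℕ) → ∑[ x < m * n ] f x ≡ ∑[ u < m ] ∑[ a < n ] f (combine u a)
sum-combine zero    f = refl
sum-combine (suc m) {n} f =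
  trans (sum-↑ n f) (cong (∑[ a < n ] f (combine (fzero {m}) a) +_) (sum-combine m {n} (f ∘ (n ↑ʳ_))))

-- Sums over increasing pairs and triples

sumAbove : ∀ {n} → Fin n → (Fin n → ℕ) → ℕ
sumAbove {n} i f = ∑[ j < n ] ([ i < j ] * f j)

pairSum : ∀ n → (Fin n → Fin n → ℕ) → ℕ
pairSum n f = ∑[ i < n ] sumAbove i (f i)

tripleSum : ∀ n → (Fin n → Fin n → Fin n → ℕ) → ℕ
tripleSum n f = ∑[ i < n ] sumAbove i (λ j → sumAbove j (f i j))

sumAbove-cong : ∀ {n} {i : Fin n} {f g : Fin n → ℕ} →
                (∀ j → toℕ i < toℕ j → f j ≡ g j) → sumAbove i f ≡ sumAbove i g
sumAbove-cong {i = i} {f} {g} f≐g = sum-cong-≗ guarded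
  where
  guarded : ∀ j → [ i < j ] * f j ≡ [ i < j ] * g j
  guarded j with toℕ i <? toℕ j
  ... | yes i<j = cong ([ i < j ] *_) (f≐g j i<j)
  ... | no  i≮j = trans (cong (_* f j) ([<]-no i≮j)) (cong (_* g j) (sym ([<]-no i≮j)))

pairSum-cong : ∀ {n} {f g : Fin n → Fin n → ℕ} →
               (∀ i j → toℕ i < toℕ j → f i j ≡ g i j) → pairSum n f ≡ pairSum n g
pairSum-cong f≐g = sum-cong-≗ λ i → sumAbove-cong (f≐g i)

tripleSum-cong : ∀ {n} {f g : Fin n → Fin n → Fin n → ℕ} →
                 (∀ i j k → toℕ i < toℕ j → toℕ j < toℕ k → f i j k ≡ g i j k) →
                 tripleSum n f ≡ tripleSum n g
tripleSum-cong f≐g = sum-cong-≗ λ i → sumAbove-cong λ j i<j → sumAbove-cong λ k j<k → f≐g i j k i<j j<k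

sumAbove-+ : ∀ {n} (i : Fin n) (f g : Fin n → ℕ) →
             sumAbove i (λ j → f j + g j) ≡ sumAbove i f + sumAbove i g
sumAbove-+ i f g = trans (sum-cong-≗ λ j → *-distribˡ-+ [ i < j ] (f j) (g j))
                         (∑-distrib-+ (λ j → [ i < j ] * f j) (λ j → [ i < j ] * g j))

pairSum-+ : ∀ n (f g : Fin n → Fin n → ℕ) →
            pairSum n (λ i j → f i j + g i j) ≡ pairSum n f + pairSum n g
pairSum-+ n f g = trans (sum-cong-≗ λ i → sumAbove-+ i (f i) (g i))
                        (∑-distrib-+ (λ i → sumAbove i (f i)) (λ i → sumAbove i (g i)))

sumAbove-*ˡ : ∀ {n} (i : Fin n) c (f : Fin n → ℕ) → sumAbove i (λ j → c * f j) ≡ c * sumAbove i f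
sumAbove-*ˡ i c f = trans (sum-cong-≗ λ j → x∙yz≈y∙xz [ i < j ] c (f j)) (sum-*ˡ c λ j → [ i < j ] * f j)

pairSum-*ˡ : ∀ n c (f : Fin n → Fin n → ℕ) → pairSum n (λ i j → c * f i j) ≡ c * pairSum n f
pairSum-*ˡ n c f = trans (sum-cong-≗ λ i → sumAbove-*ˡ i c (f i)) (sum-*ˡ c λ i → sumAbove i (f i))

pairSum-*ʳ : ∀ n c (f : Fin n → Fin n → ℕ) → pairSum n (λ i j → f i j * c) ≡ pairSum n f * c
pairSum-*ʳ n c f = trans (pairSum-cong λ i j _ → *-comm (f i j) c) (trans (pairSum-*ˡ n c f) (*-comm c _))

tripleSum-*ˡ : ∀ n c (f : Fin n → Fin n → Fin n → ℕ) →
               tripleSum n (λ i j k → c * f i j k) ≡ c * tripleSum n f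
tripleSum-*ˡ n c f = trans (sum-cong-≗ λ i → trans (sumAbove-cong λ j _ → sumAbove-*ˡ j c (f i j))
                                                   (sumAbove-*ˡ i c λ j → sumAbove j (f i j)))
                           (sum-*ˡ c λ i → sumAbove i λ j → sumAbove j (f i j))

sum-sumAbove-comm : ∀ m {n} (i : Fin n) (F : Fin m → Fin n → ℕ) →
                    ∑[ a < m ] sumAbove i (F a) ≡ sumAbove i (λ j → ∑[ a < m ] F a j)
sum-sumAbove-comm m i F = trans (∑-comm λ a j → [ i < j ] * F a j) (sum-cong-≗ λ j → sum-*ˡ [ i < j ] λ a → F a j)

sumAbove-comm : ∀ {m n} (i : Fin m) (k : Fin n) (F : Fin m → Fin n → ℕ) →
                sumAbove i (λ j → sumAbove k (F j)) ≡ sumAbove k (λ l → sumAbove i (λ j → F j l))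
sumAbove-comm {m} i k F = begin
  ∑[ j < m ] ([ i < j ] * sumAbove k (F j))            ≡⟨ sum-cong-≗ (λ j → sym (sumAbove-*ˡ k [ i < j ] (F j))) ⟩
  ∑[ j < m ] sumAbove k (λ l → [ i < j ] * F j l)      ≡⟨ sum-sumAbove-comm m k (λ j l → [ i < j ] * F j l) ⟩
  sumAbove k (λ l → sumAbove i (λ j → F j l))          ∎
  where open ≡-Reasoning

pairSum-sumAbove-comm : ∀ m {n} (i : Fin n) (F : Fin m → Fin m → Fin n → ℕ) →
                        pairSum m (λ a b → sumAbove i (F a b)) ≡ sumAbove i (λ j → pairSum m (λ a b → F a b j))
pairSum-sumAbove-comm m i F =
  trans (sum-cong-≗ λ a → sumAbove-comm a i (F a)) (sum-sumAbove-comm m i λ a j → sumAbove a λ b → F a b j)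

-- Sums over a product of index sets

combine-monoʳ-< : ∀ {m n} (u : Fin m) {a b : Fin n} →
                  toℕ a < toℕ b → toℕ (combine u a) < toℕ (combine u b)
combine-monoʳ-< {n = n} u {a} {b} a<b
  rewrite toℕ-combine u a | toℕ-combine u b = +-monoʳ-< (n * toℕ u) a<b

combine-cancelʳ-< : ∀ {m n} (u : Fin m) {a b : Fin n} →
                    toℕ (combine u a) < toℕ (combine u b) → toℕ a < toℕ b
combine-cancelʳ-< {n = n} u {a} {b} ua<ub
  rewrite toℕ-combine u a | toℕ-combine u b = +-cancelˡ-< (n * toℕ u) (toℕ a) (toℕ b) ua<ub

[combine<combine] : ∀ {m n} (u v : Fin m) (a b : Fin n) →
                    [ combine u a < combine v b ] ≡ [ u < v ] + δ u v * [ a < b ]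
[combine<combine] u v a b with <-cmp u v
... | tri< u<v u≢v _ = begin
  [ combine u a < combine v b ]  ≡⟨ [<]-yes (combine-monoˡ-< a b u<v) ⟩
  1                              ≡⟨ cong₂ (λ x y → x + y * [ a < b ]) ([<]-yes u<v) (δ-≢ u≢v) ⟨
  [ u < v ] + δ u v * [ a < b ]  ∎
  where open ≡-Reasoning
... | tri> _ u≢v v<u = begin
  [ combine u a < combine v b ]  ≡⟨ [<]-no (<-asym (combine-monoˡ-< b a v<u)) ⟩
  0                              ≡⟨ cong₂ (λ x y → x + y * [ a < b ]) ([<]-no (<-asym v<u)) (δ-≢ u≢v) ⟨
  [ u < v ] + δ u v * [ a < b ]  ∎
  where open ≡-Reasoning
... | tri≈ _ refl _ = begin
  [ combine u a < combine u b ]  ≡⟨ cong ⟦_⟧ (does-⇔ (mk⇔ (combine-cancelʳ-< u) (combine-monoʳ-< u))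
                                                        (toℕ (combine u a) <? toℕ (combine u b)) (toℕ a <? toℕ b)) ⟩
  [ a < b ]                      ≡⟨ *-identityˡ [ a < b ] ⟨
  1 * [ a < b ]                  ≡⟨ cong₂ (λ x y → x + y * [ a < b ]) ([<]-no {i = u} (<-irrefl refl)) (δ-refl u) ⟨
  [ u < u ] + δ u u * [ a < b ]  ∎
  where open ≡-Reasoning

sumAbove-combine : ∀ {m n} (v : Fin m) (b : Fin n) (h : Fin (m * n) → ℕ) →
                   sumAbove (combine v b) h
                   ≡ sumAbove v (λ w → ∑[ d < n ] h (combine w d)) + sumAbove b (λ d → h (combine v d))
sumAbove-combine {m} {n} v b h = begin
  sumAbove (combine v b) h
    ≡⟨ sum-combine m (λ x → [ combine v b < x ] * h x) ⟩
  ∑[ w < m ] ∑[ d < n ] ([ combine v b < combine w d ] * h′ w d)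
    ≡⟨ sum-cong-≗ (λ w → sum-cong-≗ λ d → split w d) ⟩
  ∑[ w < m ] ∑[ d < n ] ([ v < w ] * h′ w d + δ v w * ([ b < d ] * h′ w d))
    ≡⟨ sum-cong-≗ (λ w → ∑-distrib-+ (λ d → [ v < w ] * h′ w d) (λ d → δ v w * ([ b < d ] * h′ w d))) ⟩
  ∑[ w < m ] (∑[ d < n ] ([ v < w ] * h′ w d) + ∑[ d < n ] (δ v w * ([ b < d ] * h′ w d)))
    ≡⟨ sum-cong-≗ (λ w → cong₂ _+_ (sum-*ˡ [ v < w ] (h′ w)) (sum-*ˡ (δ v w) λ d → [ b < d ] * h′ w d)) ⟩
  ∑[ w < m ] ([ v < w ] * ∑[ d < n ] h′ w d + δ v w * sumAbove b (h′ w))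
    ≡⟨ ∑-distrib-+ (λ w → [ v < w ] * ∑[ d < n ] h′ w d) (λ w → δ v w * sumAbove b (h′ w)) ⟩
  sumAbove v (λ w → ∑[ d < n ] h′ w d) + ∑[ w < m ] (δ v w * sumAbove b (h′ w))
    ≡⟨ cong (sumAbove v (λ w → ∑[ d < n ] h′ w d) +_) (sum-δ v λ w → sumAbove b (h′ w)) ⟩
  sumAbove v (λ w → ∑[ d < n ] h′ w d) + sumAbove b (h′ v) ∎
  where
  open ≡-Reasoning
  h′ : Fin m → Fin n → ℕ
  h′ w d = h (combine w d)
  split : ∀ w d → [ combine v b < combine w d ] * h′ w d ≡ [ v < w ] * h′ w d + δ v w * ([ b < d ] * h′ w d)
  split w d = begin
    [ combine v b < combine w d ] * h′ w d         ≡⟨ cong (_* h′ w d) ([combine<combine] v w b d) ⟩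
    ([ v < w ] + δ v w * [ b < d ]) * h′ w d       ≡⟨ *-distribʳ-+ (h′ w d) [ v < w ] _ ⟩
    [ v < w ] * h′ w d + δ v w * [ b < d ] * h′ w d ≡⟨ cong ([ v < w ] * h′ w d +_) (*-assoc (δ v w) [ b < d ] (h′ w d)) ⟩
    [ v < w ] * h′ w d + δ v w * ([ b < d ] * h′ w d) ∎

sum-sumAbove-combine : ∀ {m n} (v : Fin m) (h : Fin n → Fin (m * n) → ℕ) →
                       ∑[ b < n ] sumAbove (combine v b) (h b)
                       ≡ sumAbove v (λ w → ∑[ b < n ] ∑[ d < n ] h b (combine w d))
                         + pairSum n (λ b d → h b (combine v d))
sum-sumAbove-combine {m} {n} v h = begin
  ∑[ b < n ] sumAbove (combine v b) (h b)
    ≡⟨ sum-cong-≗ (λ b → sumAbove-combine v b (h b)) ⟩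
  ∑[ b < n ] (sumAbove v (λ w → ∑[ d < n ] h b (combine w d)) + sumAbove b (λ d → h b (combine v d)))
    ≡⟨ ∑-distrib-+ (λ b → sumAbove v (λ w → ∑[ d < n ] h b (combine w d)))
                   (λ b → sumAbove b (λ d → h b (combine v d))) ⟩
  ∑[ b < n ] sumAbove v (λ w → ∑[ d < n ] h b (combine w d)) + pairSum n (λ b d → h b (combine v d))
    ≡⟨ cong (_+ pairSum n (λ b d → h b (combine v d)))
            (sum-sumAbove-comm n v λ b w → ∑[ d < n ] h b (combine w d)) ⟩
  sumAbove v (λ w → ∑[ b < n ] ∑[ d < n ] h b (combine w d)) + pairSum n (λ b d → h b (combine v d)) ∎
  where open ≡-Reasoning

pairSum-combine : ∀ m {n} (f : Fin (m * n) → Fin (m * n) → ℕ) →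
                  pairSum (m * n) f
                  ≡ pairSum m (λ u v → ∑[ a < n ] ∑[ b < n ] f (combine u a) (combine v b))
                    + ∑[ u < m ] pairSum n (λ a b → f (combine u a) (combine u b))
pairSum-combine m {n} f = begin
  pairSum (m * n) f
    ≡⟨ sum-combine m (λ x → sumAbove x (f x)) ⟩
  ∑[ u < m ] ∑[ a < n ] sumAbove (combine u a) (f (combine u a))
    ≡⟨ sum-cong-≗ {m} (λ u → sum-sumAbove-combine {n = n} u λ a → f (combine u a)) ⟩
  ∑[ u < m ] (sumAbove u (λ v → ∑[ a < n ] ∑[ b < n ] f′ u a v b) + pairSum n (λ a b → f′ u a u b))
    ≡⟨ ∑-distrib-+ (λ u → sumAbove u (λ v → ∑[ a < n ] ∑[ b < n ] f′ u a v b))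
                   (λ u → pairSum n (λ a b → f′ u a u b)) ⟩
  pairSum m (λ u v → ∑[ a < n ] ∑[ b < n ] f′ u a v b) + ∑[ u < m ] pairSum n (λ a b → f′ u a u b) ∎
  where
  open ≡-Reasoning
  f′ : Fin m → Fin n → Fin m → Fin n → ℕ
  f′ u a v b = f (combine u a) (combine v b)

tripleSum-combine : ∀ m {n} (f : Fin (m * n) → Fin (m * n) → Fin (m * n) → ℕ) →
  tripleSum (m * n) f
  ≡ (tripleSum m (λ u v w → ∑[ a < n ] ∑[ b < n ] ∑[ d < n ] f (combine u a) (combine v b) (combine w d))
     + pairSum m (λ u v → ∑[ a < n ] pairSum n (λ b d → f (combine u a) (combine v b) (combine v d))))
  + (∑[ u < m ] pairSum n (λ a b → sumAbove u (λ w → ∑[ d < n ] f (combine u a) (combine u b) (combine w d)))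
     + ∑[ u < m ] tripleSum n (λ a b d → f (combine u a) (combine u b) (combine u d)))
tripleSum-combine m {n} f =
  trans (pairSum-combine m (λ x y → sumAbove y (f x y))) (cong₂ _+_ distinctFirst sameFirst)
  where
  open ≡-Reasoning
  f′ : Fin m → Fin n → Fin m → Fin n → Fin m → Fin n → ℕ
  f′ u a v b w d = f (combine u a) (combine v b) (combine w d)

  distinctFirst : pairSum m (λ u v → ∑[ a < n ] ∑[ b < n ] sumAbove (combine v b) (f (combine u a) (combine v b)))
                  ≡ tripleSum m (λ u v w → ∑[ a < n ] ∑[ b < n ] ∑[ d < n ] f′ u a v b w d)
                    + pairSum m (λ u v → ∑[ a < n ] pairSum n (λ b d → f′ u a v b v d))
  distinctFirst = begin
    pairSum m (λ u v → ∑[ a < n ] ∑[ b < n ] sumAbove (combine v b) (f (combine u a) (combine v b)))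
      ≡⟨ pairSum-cong {m} (λ u v _ → sum-cong-≗ {n} λ a → sum-sumAbove-combine v λ b → f (combine u a) (combine v b)) ⟩
    pairSum m (λ u v → ∑[ a < n ] (sumAbove v (λ w → ∑[ b < n ] ∑[ d < n ] f′ u a v b w d)
                                   + pairSum n (λ b d → f′ u a v b v d)))
      ≡⟨ pairSum-cong {m} (λ u v _ → ∑-distrib-+ (λ a → sumAbove v (λ w → ∑[ b < n ] ∑[ d < n ] f′ u a v b w d))
                                             (λ a → pairSum n (λ b d → f′ u a v b v d))) ⟩
    pairSum m (λ u v → ∑[ a < n ] sumAbove v (λ w → ∑[ b < n ] ∑[ d < n ] f′ u a v b w d)
                       + ∑[ a < n ] pairSum n (λ b d → f′ u a v b v d))
      ≡⟨ pairSum-cong {m} (λ u v _ → cong (_+ ∑[ a < n ] pairSum n (λ b d → f′ u a v b v d))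
                                      (sum-sumAbove-comm n v λ a w → ∑[ b < n ] ∑[ d < n ] f′ u a v b w d)) ⟩
    pairSum m (λ u v → sumAbove v (λ w → ∑[ a < n ] ∑[ b < n ] ∑[ d < n ] f′ u a v b w d)
                       + ∑[ a < n ] pairSum n (λ b d → f′ u a v b v d))
      ≡⟨ pairSum-+ m (λ u v → sumAbove v (λ w → ∑[ a < n ] ∑[ b < n ] ∑[ d < n ] f′ u a v b w d))
                     (λ u v → ∑[ a < n ] pairSum n (λ b d → f′ u a v b v d)) ⟩
    tripleSum m (λ u v w → ∑[ a < n ] ∑[ b < n ] ∑[ d < n ] f′ u a v b w d)
      + pairSum m (λ u v → ∑[ a < n ] pairSum n (λ b d → f′ u a v b v d)) ∎

  sameFirst : ∑[ u < m ] pairSum n (λ a b → sumAbove (combine u b) (f (combine u a) (combine u b)))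
              ≡ ∑[ u < m ] pairSum n (λ a b → sumAbove u (λ w → ∑[ d < n ] f′ u a u b w d))
                + ∑[ u < m ] tripleSum n (λ a b d → f′ u a u b u d)
  sameFirst = begin
    ∑[ u < m ] pairSum n (λ a b → sumAbove (combine u b) (f (combine u a) (combine u b)))
      ≡⟨ sum-cong-≗ {m} (λ u → pairSum-cong {n} λ a b _ → sumAbove-combine u b (f (combine u a) (combine u b))) ⟩
    ∑[ u < m ] pairSum n (λ a b → sumAbove u (λ w → ∑[ d < n ] f′ u a u b w d) + sumAbove b (λ d → f′ u a u b u d))
      ≡⟨ sum-cong-≗ (λ u → pairSum-+ n (λ a b → sumAbove u (λ w → ∑[ d < n ] f′ u a u b w d))
                                       (λ a b → sumAbove b (λ d → f′ u a u b u d))) ⟩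
    ∑[ u < m ] (pairSum n (λ a b → sumAbove u (λ w → ∑[ d < n ] f′ u a u b w d))
                + tripleSum n (λ a b d → f′ u a u b u d))
      ≡⟨ ∑-distrib-+ (λ u → pairSum n (λ a b → sumAbove u (λ w → ∑[ d < n ] f′ u a u b w d)))
                     (λ u → tripleSum n (λ a b d → f′ u a u b u d)) ⟩
    ∑[ u < m ] pairSum n (λ a b → sumAbove u (λ w → ∑[ d < n ] f′ u a u b w d))
      + ∑[ u < m ] tripleSum n (λ a b d → f′ u a u b u d) ∎

module AdditiveMeasure {A : Set} (μ : List A → ℕ) (μ-[] : μ [] ≡ 0)
                       (μ-++ : ∀ xs ys → μ (xs ++ ys) ≡ μ xs + μ ys) where

  μ-concatMap-tabulate : ∀ {B : Set} {n} (f : B → List A) (g : Fin n → B) →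
                         μ (concatMap f (tabulate g)) ≡ ∑[ i < n ] μ (f (g i))
  μ-concatMap-tabulate {n = zero}  f g = μ-[]
  μ-concatMap-tabulate {n = suc n} f g =
    trans (μ-++ (f (g fzero)) _) (cong (μ (f (g fzero)) +_) (μ-concatMap-tabulate f (g ∘ fsuc)))

  μ-if : ∀ b xs → μ (if b then xs else []) ≡ ⟦ b ⟧ * μ xs
  μ-if true  xs = sym (+-identityʳ (μ xs))
  μ-if false xs = μ-[]

  μ-if-< : ∀ {n} (i j : Fin n) xs → μ (if ⌊ toℕ i <? toℕ j ⌋ then xs else []) ≡ [ i < j ] * μ xs
  μ-if-< i j xs = trans (μ-if _ xs) (cong (λ b → ⟦ b ⟧ * μ xs) (isYes≗does (toℕ i <? toℕ j)))

bcount-++ : ∀ xs ys → bcount (xs ++ ys) ≡ bcount xs + bcount ys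
bcount-++ []           ys = refl
bcount-++ (true  ∷ xs) ys = cong suc (bcount-++ xs ys)
bcount-++ (false ∷ xs) ys = bcount-++ xs ys

bcount-[_] : ∀ b → bcount (b ∷ []) ≡ ⟦ b ⟧
bcount-[ true  ] = refl
bcount-[ false ] = refl

length-filter-[_] : ∀ {A : Set} {P : A → Set} {P? : Decidable P} x → length (filter P? (x ∷ [])) ≡ ⟦ does (P? x) ⟧
length-filter-[_] {P? = P?} x with does (P? x)
... | true  = refl
... | false = refl

edgeCount≡pairSum : ∀ G → edgeCount G ≡ pairSum (n G) (λ i j → ⟦ adj G i j ⟧)
edgeCount≡pairSum G =
  trans (μ-concatMap-tabulate row id)
        (sum-cong-≗ λ i → trans (μ-concatMap-tabulate (entry i) id)
                                (sum-cong-≗ λ j → trans (μ-if-< i j _) (cong ([ i < j ] *_) bcount-[ adj G i j ])))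
  where
  V : Set
  V = Fin (n G)
  entry : V → V → List (V × V)
  entry i j = if ⌊ toℕ i <? toℕ j ⌋ then (i , j) ∷ [] else []
  row : V → List (V × V)
  row i = concatMap (entry i) (allFin (n G))
  μ : List (V × V) → ℕ
  μ = bcount ∘ map (λ (i , j) → adj G i j)
  μ-++ : ∀ xs ys → μ (xs ++ ys) ≡ μ xs + μ ys
  μ-++ xs ys = trans (cong bcount (map-++ _ xs ys)) (bcount-++ (map _ xs) _)
  open AdditiveMeasure μ refl μ-++

exactly : ℕ → Bool → Bool → Bool → ℕ
exactly e x y z = ⟦ does (bcount (x ∷ y ∷ z ∷ []) ℕ.≟ e) ⟧

exactly-cong : ∀ {e x x′ y y′ z z′} → x ≡ x′ → y ≡ y′ → z ≡ z′ → exactly e x y z ≡ exactly e x′ y′ z′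
exactly-cong refl refl refl = refl

exactly-swap : ∀ e x y → exactly e x y y ≡ exactly e y y x
exactly-swap e false false = refl
exactly-swap e false true  = refl
exactly-swap e true  false = refl
exactly-swap e true  true  = refl

exactly-3 : ∀ x y → exactly 3 x x y ≡ ⟦ x ⟧ * ⟦ y ⟧
exactly-3 false false = refl
exactly-3 false true  = refl
exactly-3 true  false = refl
exactly-3 true  true  = refl

exactly-2 : ∀ x y → exactly 2 x x y ≡ ⟦ x ⟧ * ⟦ not y ⟧
exactly-2 false false = refl
exactly-2 false true  = refl
exactly-2 true  false = refl
exactly-2 true  true  = refl

exactly-1 : ∀ x y → exactly 1 x x y ≡ ⟦ not x ⟧ * ⟦ y ⟧
exactly-1 false false = refl
exactly-1 false true  = refl
exactly-1 true  false = refl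
exactly-1 true  true  = refl

exactly-0 : ∀ x y → exactly 0 x x y ≡ ⟦ not x ⟧ * ⟦ not y ⟧
exactly-0 false false = refl
exactly-0 false true  = refl
exactly-0 true  false = refl
exactly-0 true  true  = refl

inducedCount3≡tripleSum : ∀ G e →
  inducedCount3 G e ≡ tripleSum (n G) (λ i j k → exactly e (adj G i j) (adj G i k) (adj G j k))
inducedCount3≡tripleSum G e =
  trans (μ-concatMap-tabulate plane id)
        (sum-cong-≗ λ i → trans (μ-concatMap-tabulate (row i) id)
                                (sum-cong-≗ λ j → trans (μ-concatMap-tabulate (entry i j) id)
                                                        (trans (sum-cong-≗ (μ-entry i j))
                                                               (sum-*ˡ [ i < j ] λ k → [ j < k ] * K i j k))))
  where
  V : Set
  V = Fin (n G)
  K : V → V → V → ℕ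
  K i j k = exactly e (adj G i j) (adj G i k) (adj G j k)
  P? : (t : V × V × V) → Dec (edgesOn G t ≡ e)
  P? t = edgesOn G t ℕ.≟ e
  entry : V → V → V → List (V × V × V)
  entry i j k = if ⌊ toℕ i <? toℕ j ⌋ then (if ⌊ toℕ j <? toℕ k ⌋ then (i , j , k) ∷ [] else []) else []
  row : V → V → List (V × V × V)
  row i j = concatMap (entry i j) (allFin (n G))
  plane : V → List (V × V × V)
  plane i = concatMap (row i) (allFin (n G))
  μ : List (V × V × V) → ℕ
  μ = length ∘ filter P?
  μ-++ : ∀ xs ys → μ (xs ++ ys) ≡ μ xs + μ ys
  μ-++ xs ys = trans (cong length (filter-++ P? xs ys)) (length-++ (filter P? xs))
  open AdditiveMeasure μ refl μ-++
  μ-entry : ∀ i j k → μ (entry i j k) ≡ [ i < j ] * ([ j < k ] * K i j k)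
  μ-entry i j k = trans (μ-if-< i j _)
                        (cong ([ i < j ] *_) (trans (μ-if-< j k _)
                                                    (cong ([ j < k ] *_) (length-filter-[_] {P? = P?} (i , j , k)))))

-- Edge density

pairSum-suc : ∀ n (f : Fin (suc n) → Fin (suc n) → ℕ) →
              pairSum (suc n) f ≡ ∑[ j < n ] f fzero (fsuc j) + pairSum n (λ i j → f (fsuc i) (fsuc j))
pairSum-suc n f = cong₂ _+_ (sum-cong-≗ λ j → *-identityˡ (f fzero (fsuc j)))
                            (sum-cong-≗ λ i → sum-cong-≗ λ j → cong (_* f (fsuc i) (fsuc j)) ([<]-suc i j))

pairSum-one : ∀ n → pairSum n (λ _ _ → 1) ≡ n C 2
pairSum-one zero    = refl
pairSum-one (suc n) = begin
  pairSum (suc n) (λ _ _ → 1)        ≡⟨ pairSum-suc n (λ _ _ → 1) ⟩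
  ∑[ j < n ] 1 + pairSum n (λ _ _ → 1) ≡⟨ cong₂ _+_ (trans (sum-const n 1) (*-identityʳ n)) (pairSum-one n) ⟩
  n + n C 2                          ≡⟨ cong (_+ n C 2) (nC1≡n n) ⟨
  n C 1 + n C 2                      ≡⟨ nCk+nC[k+1]≡[n+1]C[k+1] n 1 ⟩
  suc n C 2                          ∎
  where open ≡-Reasoning

edges nonEdges : Graph → ℕ
edges    G = pairSum (n G) (λ i j → ⟦ adj G i j ⟧)
nonEdges G = pairSum (n G) (λ i j → ⟦ not (adj G i j) ⟧)

edges+nonEdges : ∀ G → edges G + nonEdges G ≡ n G C 2
edges+nonEdges G = begin
  edges G + nonEdges G                                   ≡⟨ pairSum-+ (n G) _ _ ⟨
  pairSum (n G) (λ i j → ⟦ adj G i j ⟧ + ⟦ not (adj G i j) ⟧) ≡⟨ pairSum-cong (λ i j _ → ⟦b⟧+⟦not-b⟧ (adj G i j)) ⟩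
  pairSum (n G) (λ _ _ → 1)                              ≡⟨ pairSum-one (n G) ⟩
  n G C 2                                                ∎
  where
  open ≡-Reasoning
  ⟦b⟧+⟦not-b⟧ : ∀ b → ⟦ b ⟧ + ⟦ not b ⟧ ≡ 1
  ⟦b⟧+⟦not-b⟧ true  = refl
  ⟦b⟧+⟦not-b⟧ false = refl

twoSymmetric⇒edges≡nonEdges : ∀ G → TwoSymmetric G → edges G ≡ nonEdges G
twoSymmetric⇒edges≡nonEdges G (inj₁ n<2) =
  trans (m+n≡0⇒m≡0 (edges G) noPairs) (sym (m+n≡0⇒n≡0 (edges G) noPairs))
  where
  noPairs : edges G + nonEdges G ≡ 0
  noPairs = trans (edges+nonEdges G) (k>n⇒nCk≡0 n<2)
twoSymmetric⇒edges≡nonEdges G (inj₂ 2E≡C) =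
  trans (sym (+-identityʳ (edges G))) (+-cancelˡ-≡ (edges G) _ _ (begin
    edges G + (edges G + 0)  ≡⟨ cong (2 *_) (edgeCount≡pairSum G) ⟨
    2 * edgeCount G          ≡⟨ 2E≡C ⟩
    n G C 2                  ≡⟨ edges+nonEdges G ⟨
    edges G + nonEdges G     ∎))
  where open ≡-Reasoning

edges≡nonEdges⇒twoSymmetric : ∀ G → edges G ≡ nonEdges G → TwoSymmetric G
edges≡nonEdges⇒twoSymmetric G E≡Ē = inj₂ (begin
  2 * edgeCount G             ≡⟨ cong (2 *_) (edgeCount≡pairSum G) ⟩
  edges G + (edges G + 0)     ≡⟨ cong (edges G +_) (trans (+-identityʳ (edges G)) E≡Ē) ⟩
  edges G + nonEdges G        ≡⟨ edges+nonEdges G ⟩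
  n G C 2                     ∎)
  where open ≡-Reasoning

-- Inflation

module _ (G H : Graph) where
  private
    N M : ℕ
    N = n G
    M = n H
    Ā : Fin (N * M) → Fin (N * M) → Bool
    Ā = adj (inflate G H)

  adj-inflate : ∀ u a v b → Ā (combine u a) (combine v b) ≡ inflAdj G H (u , a) (v , b)
  adj-inflate u a v b = cong₂ (inflAdj G H) (remQuot-combine u a) (remQuot-combine v b)

  inflAdj-≢ : ∀ {u v} a b → ¬ u ≡ v → inflAdj G H (u , a) (v , b) ≡ adj G u v
  inflAdj-≢ {u} {v} a b u≢v with u ≟ v
  ... | yes u≡v = ⊥-elim (u≢v u≡v)
  ... | no  _   = refl

  inflAdj-≡ : ∀ u a b → inflAdj G H (u , a) (u , b) ≡ adj H a b
  inflAdj-≡ u a b with u ≟ u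
  ... | yes _   = refl
  ... | no  u≢u = ⊥-elim (u≢u refl)

  adj-inflate-≢ : ∀ {u v} a b → ¬ u ≡ v → Ā (combine u a) (combine v b) ≡ adj G u v
  adj-inflate-≢ a b u≢v = trans (adj-inflate _ a _ b) (inflAdj-≢ a b u≢v)

  adj-inflate-≡ : ∀ u a b → Ā (combine u a) (combine u b) ≡ adj H a b
  adj-inflate-≡ u a b = trans (adj-inflate u a u b) (inflAdj-≡ u a b)

  pairSum-inflate : ∀ (φ : Bool → ℕ) →
                    pairSum (N * M) (λ x y → φ (Ā x y))
                    ≡ M * (M * pairSum N (λ u v → φ (adj G u v))) + N * pairSum M (λ a b → φ (adj H a b))
  pairSum-inflate φ = trans (pairSum-combine N (λ x y → φ (Ā x y))) (cong₂ _+_ acrossBlocks withinBlocks)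
    where
    acrossBlocks : pairSum N (λ u v → ∑[ a < M ] ∑[ b < M ] φ (Ā (combine u a) (combine v b)))
                   ≡ M * (M * pairSum N (λ u v → φ (adj G u v)))
    acrossBlocks = begin
      pairSum N (λ u v → ∑[ a < M ] ∑[ b < M ] φ (Ā (combine u a) (combine v b)))
        ≡⟨ pairSum-cong (λ u v u<v → trans (sum-cong-≗ {M} λ a → sum-cong-≗ {M} λ b → cong φ (adj-inflate-≢ a b (<⇒≢ u<v)))
                                           (sum-const² M (φ (adj G u v)))) ⟩
      pairSum N (λ u v → M * (M * φ (adj G u v)))
        ≡⟨ pairSum-*ˡ N M (λ u v → M * φ (adj G u v)) ⟩
      M * pairSum N (λ u v → M * φ (adj G u v))
        ≡⟨ cong (M *_) (pairSum-*ˡ N M λ u v → φ (adj G u v)) ⟩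
      M * (M * pairSum N (λ u v → φ (adj G u v))) ∎
      where open ≡-Reasoning
    withinBlocks : ∑[ u < N ] pairSum M (λ a b → φ (Ā (combine u a) (combine u b))) ≡ N * pairSum M (λ a b → φ (adj H a b))
    withinBlocks = trans (sum-cong-≗ λ u → pairSum-cong λ a b _ → cong φ (adj-inflate-≡ u a b)) (sum-const N _)

  -- m_e of the header: a triple (u , x) , (v , a) , (v , b) with u ≠ v has edges uv, uv and ab.
  twoBlockCount : ℕ → ℕ
  twoBlockCount e = pairSum N (λ u v → pairSum M (λ a b → exactly e (adj G u v) (adj G u v) (adj H a b)))

  inducedCount3-inflate : ∀ e → inducedCount3 (inflate G H) e
                                ≡ (M * (M * (M * inducedCount3 G e)) + M * twoBlockCount e)
                                  + (M * twoBlockCount e + N * inducedCount3 H e)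
  inducedCount3-inflate e = begin
    inducedCount3 (inflate G H) e
      ≡⟨ inducedCount3≡tripleSum (inflate G H) e ⟩
    tripleSum (N * M) (λ x y z → exactly e (Ā x y) (Ā x z) (Ā y z))
      ≡⟨ tripleSum-combine N (λ x y z → exactly e (Ā x y) (Ā x z) (Ā y z)) ⟩
    _ ≡⟨ cong₂ _+_ (cong₂ _+_ threeBlocks lastTwoShareBlock) (cong₂ _+_ firstTwoShareBlock oneBlock) ⟩
    (M * (M * (M * inducedCount3 G e)) + M * twoBlockCount e) + (M * twoBlockCount e + N * inducedCount3 H e) ∎
    where
    open ≡-Reasoning
    F : Fin N → Fin M → Fin N → Fin M → Fin N → Fin M → ℕ
    F u a v b w d = exactly e (Ā (combine u a) (combine v b)) (Ā (combine u a) (combine w d)) (Ā (combine v b) (combine w d))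

    threeBlocks : tripleSum N (λ u v w → ∑[ a < M ] ∑[ b < M ] ∑[ d < M ] F u a v b w d)
                  ≡ M * (M * (M * inducedCount3 G e))
    threeBlocks = begin
      tripleSum N (λ u v w → ∑[ a < M ] ∑[ b < M ] ∑[ d < M ] F u a v b w d)
        ≡⟨ tripleSum-cong (λ u v w u<v v<w → trans
             (sum-cong-≗ {M} λ a → sum-cong-≗ {M} λ b → sum-cong-≗ {M} λ d →
               exactly-cong (adj-inflate-≢ a b (<⇒≢ u<v)) (adj-inflate-≢ a d (<⇒≢ (<-trans u<v v<w)))
                            (adj-inflate-≢ b d (<⇒≢ v<w)))
             (sum-const³ M (K u v w))) ⟩
      tripleSum N (λ u v w → M * (M * (M * K u v w)))
        ≡⟨ tripleSum-*ˡ N M (λ u v w → M * (M * K u v w)) ⟩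
      M * tripleSum N (λ u v w → M * (M * K u v w))
        ≡⟨ cong (M *_) (tripleSum-*ˡ N M λ u v w → M * K u v w) ⟩
      M * (M * tripleSum N (λ u v w → M * K u v w))
        ≡⟨ cong (λ t → M * (M * t)) (tripleSum-*ˡ N M K) ⟩
      M * (M * (M * tripleSum N K))
        ≡⟨ cong (λ t → M * (M * (M * t))) (inducedCount3≡tripleSum G e) ⟨
      M * (M * (M * inducedCount3 G e)) ∎
      where
      K : Fin N → Fin N → Fin N → ℕ
      K u v w = exactly e (adj G u v) (adj G u w) (adj G v w)

    lastTwoShareBlock : pairSum N (λ u v → ∑[ a < M ] pairSum M (λ b d → F u a v b v d)) ≡ M * twoBlockCount e
    lastTwoShareBlock =
      trans (pairSum-cong λ u v u<v →
               trans (sum-cong-≗ {M} λ a → pairSum-cong {M} λ b d _ →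
                        exactly-cong (adj-inflate-≢ a b (<⇒≢ u<v)) (adj-inflate-≢ a d (<⇒≢ u<v)) (adj-inflate-≡ v b d))
                     (sum-const M _))
            (pairSum-*ˡ N M _)

    firstTwoShareBlock : ∑[ u < N ] pairSum M (λ a b → sumAbove u (λ w → ∑[ d < M ] F u a u b w d)) ≡ M * twoBlockCount e
    firstTwoShareBlock = begin
      ∑[ u < N ] pairSum M (λ a b → sumAbove u (λ w → ∑[ d < M ] F u a u b w d))
        ≡⟨ sum-cong-≗ (λ u → pairSum-cong λ a b _ → sumAbove-cong λ w u<w →
             trans (sum-cong-≗ {M} λ d →
                      trans (exactly-cong (adj-inflate-≡ u a b) (adj-inflate-≢ a d (<⇒≢ u<w)) (adj-inflate-≢ b d (<⇒≢ u<w)))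
                            (exactly-swap e (adj H a b) (adj G u w)))
                   (sum-const M (L u w a b))) ⟩
      ∑[ u < N ] pairSum M (λ a b → sumAbove u (λ w → M * L u w a b))
        ≡⟨ sum-cong-≗ (λ u → trans (pairSum-cong λ a b _ → sumAbove-*ˡ u M (λ w → L u w a b))
                                   (pairSum-*ˡ M M λ a b → sumAbove u λ w → L u w a b)) ⟩
      ∑[ u < N ] (M * pairSum M (λ a b → sumAbove u (λ w → L u w a b)))
        ≡⟨ sum-*ˡ M (λ u → pairSum M λ a b → sumAbove u λ w → L u w a b) ⟩
      M * ∑[ u < N ] pairSum M (λ a b → sumAbove u (λ w → L u w a b))
        ≡⟨ cong (M *_) (sum-cong-≗ λ u → pairSum-sumAbove-comm M u λ a b w → L u w a b) ⟩
      M * twoBlockCount e ∎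
      where
      L : Fin N → Fin N → Fin M → Fin M → ℕ
      L u w a b = exactly e (adj G u w) (adj G u w) (adj H a b)

    oneBlock : ∑[ u < N ] tripleSum M (λ a b d → F u a u b u d) ≡ N * inducedCount3 H e
    oneBlock =
      trans (sum-cong-≗ λ u → tripleSum-cong λ a b d _ _ →
               exactly-cong (adj-inflate-≡ u a b) (adj-inflate-≡ u a d) (adj-inflate-≡ u b d))
            (trans (sum-const N _) (cong (N *_) (sym (inducedCount3≡tripleSum H e))))

  twoBlockCount-factor : ∀ e (φ ψ : Bool → ℕ) → (∀ x y → exactly e x x y ≡ φ x * ψ y) →
                         twoBlockCount e ≡ pairSum N (λ u v → φ (adj G u v)) * pairSum M (λ a b → ψ (adj H a b))
  twoBlockCount-factor e φ ψ exactly≡φψ =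
    trans (pairSum-cong λ u v _ → trans (pairSum-cong λ a b _ → exactly≡φψ (adj G u v) (adj H a b))
                                        (pairSum-*ˡ M (φ (adj G u v)) λ a b → ψ (adj H a b)))
          (pairSum-*ʳ N (pairSum M λ a b → ψ (adj H a b)) λ u v → φ (adj G u v))

  inducedCount3-inflate-cong : ∀ {e e′} → inducedCount3 G e ≡ inducedCount3 G e′ → inducedCount3 H e ≡ inducedCount3 H e′ →
                               twoBlockCount e ≡ twoBlockCount e′ → inducedCount3 (inflate G H) e ≡ inducedCount3 (inflate G H) e′
  inducedCount3-inflate-cong {e} {e′} Ge≡Ge′ He≡He′ Be≡Be′
    rewrite inducedCount3-inflate e | inducedCount3-inflate e′ | Ge≡Ge′ | He≡He′ | Be≡Be′ = refl

  edges≡nonEdges-inflate : edges G ≡ nonEdges G → edges H ≡ nonEdges H → edges (inflate G H) ≡ nonEdges (inflate G H)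
  edges≡nonEdges-inflate EG≡ĒG EH≡ĒH = begin
    edges (inflate G H)                             ≡⟨ pairSum-inflate ⟦_⟧ ⟩
    M * (M * edges G) + N * edges H                 ≡⟨ cong₂ (λ x y → M * (M * x) + N * y) EG≡ĒG EH≡ĒH ⟩
    M * (M * nonEdges G) + N * nonEdges H           ≡⟨ pairSum-inflate (⟦_⟧ ∘ not) ⟨
    nonEdges (inflate G H)                          ∎
    where open ≡-Reasoning

mainTheorem14 : (G H : Graph) → Almost3Symmetric G → Almost3Symmetric H
    → Almost3Symmetric (inflate G H)
mainTheorem14 G H sG sH = record
  { twoSym = edges≡nonEdges⇒twoSymmetric (inflate G H) (edges≡nonEdges-inflate G H EG≡ĒG EH≡ĒH)
  ; triEq  = inducedCount3-inflate-cong G H (triEq sG) (triEq sH) (begin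
      twoBlockCount G H 3        ≡⟨ twoBlockCount-factor G H 3 ⟦_⟧ ⟦_⟧ exactly-3 ⟩
      edges G * edges H          ≡⟨ cong₂ _*_ EG≡ĒG EH≡ĒH ⟩
      nonEdges G * nonEdges H    ≡⟨ twoBlockCount-factor G H 0 (⟦_⟧ ∘ not) (⟦_⟧ ∘ not) exactly-0 ⟨
      twoBlockCount G H 0        ∎)
  ; pathEq = inducedCount3-inflate-cong G H (pathEq sG) (pathEq sH) (begin
      twoBlockCount G H 2        ≡⟨ twoBlockCount-factor G H 2 ⟦_⟧ (⟦_⟧ ∘ not) exactly-2 ⟩
      edges G * nonEdges H       ≡⟨ cong₂ _*_ EG≡ĒG (sym EH≡ĒH) ⟩
      nonEdges G * edges H       ≡⟨ twoBlockCount-factor G H 1 (⟦_⟧ ∘ not) ⟦_⟧ exactly-1 ⟨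
      twoBlockCount G H 1        ∎)
  }
  where
  open Almost3Symmetric
  open ≡-Reasoning
  EG≡ĒG : edges G ≡ nonEdges G
  EG≡ĒG = twoSymmetric⇒edges≡nonEdges G (twoSym sG)
  EH≡ĒH : edges H ≡ nonEdges H
  EH≡ĒH = twoSymmetric⇒edges≡nonEdges H (twoSym sH)
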